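{- Let $G$ be a finite group. Then any good sublattice of the coset lattice $\mathscr C(G)$ is strongly coset-like.
   Context: The coset lattice $\mathscr C(G)$ is the set of all left cosets $xK$ of all subgroups $K\leq G$, together with the empty set, ordered by inclusion; meet is intersection and $x_1H_1\vee x_2H_2=x_1H$ where $H=\langle x_1^{ -1}x_2,H_1,H_2\rangle$. Its join-irreducible elements are exactly the singletons $\{g\}$, $g\in G$. $G$ acts on $\mathscr C(G)$ by $(xK)^g=(gx)K$. A sublattice $L$ of $\mathscr C(G)$ (a subset closed under the meet and join of $\mathscr C(G)$) is good if: (i) there is a normal subgroup $H\trianglelefteq G$ such that $H$ acts on $L$ via the restricted action, i.e. $(hx)K\in L$ whenever $xK\in L$ and $h\in H$; (ii) every join-irreducible element of $L$ is a join-irreducible element of $\mathscr C(G)$ (so $J(L)$ corresponds to a subset of $G$); and (iii) no three elements of $J(L)$ correspond to group elements lying in three distinct cosets of $H$. For a finite lattice $M$ with bottom $\widehat 0$, $J(M)$ denotes its set of join-irreducible elements (elements $x\neq\widehat 0$ such that $x=a\vee b$ implies $a=x$ or $b=x$) and $J_x=\{j\in J(M):j\leq x\}$; $M$ is strongly coset-like if $|J_x|$ divides $|J(M)|$ for every $x\in M\setminus\{\widehat 0\}$. -}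

module Defs where

open import Level using (0ℓ)
open import Data.Nat using (ℕ)
open import Data.Fin using (Fin)
open import Data.Fin.Subset using (Subset; _∈_; _∉_; _⊆_; _∩_; ⁅_⁆) renaming (⊥ to ∅)
open import Data.Vec using (tabulate; lookup)
open import Data.Product using (Σ; ∃; _×_; _,_)
open import Data.Sum using (_⊎_)
open import Data.List using (List; length)
open import Data.List.Relation.Unary.Unique.Propositional using (Unique)
import Data.List.Membership.Propositional as L
open import Relation.Binary.PropositionalEquality using (_≡_)
open import Relation.Nullary using (¬_)
open import Relation.Unary using (Pred)
open import Algebra.Structures using (IsGroup)
open import Data.Nat.Divisibility using (_∣_)

-- A finite group: a group structure (with propositional equality) on Fin n.
-- Every finite group of order n is isomorphic to one of these.
record FinGroup (n : ℕ) : Set where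
  field
    _·_     : Fin n → Fin n → Fin n
    e       : Fin n
    inv     : Fin n → Fin n
    isGroup : IsGroup _≡_ _·_ e inv
  infixl 7 _·_

module _ {n : ℕ} (G : FinGroup n) where
  open FinGroup G

  IsSubgroup : Subset n → Set
  IsSubgroup K = (e ∈ K)
               × (∀ a b → a ∈ K → b ∈ K → a · b ∈ K)
               × (∀ a → a ∈ K → inv a ∈ K)

  IsNormalSubgroup : Subset n → Set
  IsNormalSubgroup H = IsSubgroup H × (∀ g h → h ∈ H → g · h · inv g ∈ H)

  IsLeftCoset : Subset n → Set
  IsLeftCoset S = Σ (Fin n) λ x → Σ (Subset n) λ K → IsSubgroup K ×
                  (∀ g → (g ∈ S → ∃ λ k → k ∈ K × g ≡ x · k)
                       × ((∃ λ k → k ∈ K × g ≡ x · k) → g ∈ S))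

  -- elements of the coset lattice 𝒞(G): left cosets and the empty set
  InC : Subset n → Set
  InC S = (S ≡ ∅) ⊎ IsLeftCoset S

  IsJoinC : Subset n → Subset n → Subset n → Set
  IsJoinC a b c = InC c × a ⊆ c × b ⊆ c ×
                  (∀ d → InC d → a ⊆ d → b ⊆ d → c ⊆ d)

  IsSublattice : Pred (Subset n) 0ℓ → Set
  IsSublattice L = (∀ S → L S → InC S)
                 × (∀ a b → L a → L b → L (a ∩ b))
                 × (∀ a b c → L a → L b → IsJoinC a b c → L c)

  -- left translation by h:  xK ↦ (hx)K, i.e. g ∈ h·S ⇔ h⁻¹g ∈ S
  translate : Fin n → Subset n → Subset n
  translate h S = tabulate (λ g → lookup S (inv h · g))

  IsBottom : Pred (Subset n) 0ℓ → Subset n → Set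
  IsBottom L z = L z × (∀ y → L y → z ⊆ y)

  -- join-irreducible elements of the lattice L (join in L = join in 𝒞(G))
  IsJoinIrr : Pred (Subset n) 0ℓ → Subset n → Set
  IsJoinIrr L x = L x × ¬ IsBottom L x ×
                  (∀ a b → L a → L b → IsJoinC a b x → (a ≡ x) ⊎ (b ≡ x))

  IsGood : Pred (Subset n) 0ℓ → Set
  IsGood L = IsSublattice L ×
    (Σ (Subset n) λ H → IsNormalSubgroup H
      × (∀ S h → L S → h ∈ H → L (translate h S))
      × (∀ j → IsJoinIrr L j → ∃ λ g → j ≡ ⁅ g ⁆)
      × (∀ g₁ g₂ g₃ → IsJoinIrr L ⁅ g₁ ⁆ → IsJoinIrr L ⁅ g₂ ⁆ → IsJoinIrr L ⁅ g₃ ⁆ →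
           ¬ ((inv g₁ · g₂ ∉ H) × (inv g₁ · g₃ ∉ H) × (inv g₂ · g₃ ∉ H))))

-- xs lists exactly the elements satisfying P, without repetition
-- (so length xs is the cardinality of P)
Enumerates : {A : Set} → Pred A 0ℓ → List A → Set
Enumerates P xs = Unique xs × (∀ x → (x L.∈ xs → P x) × (P x → x L.∈ xs))

module _ {n : ℕ} (G : FinGroup n) where
  StronglyCosetLike : Pred (Subset n) 0ℓ → Set
  StronglyCosetLike L =
    ∀ (js : List (Subset n)) → Enumerates (IsJoinIrr G L) js →
    ∀ x → L x → ¬ IsBottom G L x →
    ∀ (ks : List (Subset n)) → Enumerates (λ j → IsJoinIrr G L j × j ⊆ x) ks →
    length ks ∣ length js

{-# OPTIONS --safe #-}
-- The join-irreducibles of L are the singletons ⁅ g ⁆ for g in a set S ⊆ G that is closed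
-- under left multiplication by H and, by (iii), meets at most two cosets of H. Once ∅ ∈ L,
-- every non-bottom x ∈ L is a coset yK with y ∈ S, and J_x corresponds to the slice S ∩ yK.
-- The slices S ∩ tK (t ∈ S) partition S and all have the same size: if t⁻¹t' ∈ H, left
-- multiplication by tt'⁻¹ ∈ H maps S ∩ t'K onto S ∩ tK; otherwise every z ∈ S lies in tH
-- or t'H, and z ↦ tz⁻¹t' does. Hence |J_x| = |S ∩ yK| divides |S| = |J(L)|.
module Submission where

open import Defs
open import Level using (0ℓ)
open import Data.Nat using (ℕ; suc; _+_; _<_)
open import Data.Nat.Properties using (+-suc)
open import Data.Nat.Induction using (<-wellFounded)
open import Data.Nat.Divisibility using (_∣_; _∣?_; _∣0; ∣m∣n⇒∣m+n; ∣-refl)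
open import Data.Fin using (Fin)
open import Data.Fin.Subset using (Subset; _∈_; _∉_; _⊆_; _⊂_; _∩_; ⁅_⁆; ∣_∣; Nonempty) renaming (⊥ to ∅)
open import Data.Fin.Subset.Properties
  using ( _∈?_; _⊂?_; nonempty?; Empty-unique; ⊥⊆; ∉⊥; x∈⁅x⁆; x∈⁅y⁆⇒x≡y; x∈⁅y⁆⇔x≡y; x∈p∩q⁻
        ; ⊆-reflexive; ⊆-antisym; p⊂q⇒∣p∣<∣q∣)
open import Data.Fin.Properties using (any?)
open import Algebra.Bundles using (Group)
open import Algebra.Structures using (IsGroup)
import Algebra.Properties.Group as GroupProperties
open import Data.Product using (∃; _×_; _,_; proj₁; proj₂)
open import Data.Sum using (_⊎_; inj₁; inj₂)
open import Data.Vec using (lookup)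
open import Data.Vec.Properties using (≡-dec; lookup∘tabulate; []=⇒lookup; lookup⇒[]=)
open import Data.List using (List; []; _∷_; length; map; filter; allFin)
open import Data.List.Properties using (length-map; filter-reject; filter-notAll)
open import Data.List.Relation.Unary.Any using (here)
import Data.List.Relation.Unary.Unique.Propositional.Properties as Unique
open import Data.List.Membership.Propositional using () renaming (_∈_ to _∈ˡ_)
import Data.List.Membership.DecPropositional as DecMembership
open import Data.List.Membership.Propositional.Properties
  using (∈-map⁺; ∈-map⁻; ∈-filter⁺; ∈-filter⁻; ∈-allFin)
open import Data.List.Membership.Propositional.Properties.WithK using (unique∧set⇒bag)
open import Data.List.Relation.Binary.BagAndSetEquality using (∼bag⇒↭)
open import Data.List.Relation.Binary.Permutation.Propositional.Properties using (↭-length)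
open import Data.Empty using (⊥-elim)
import Data.Bool as Bool
open import Function using (_∘_)
open import Function.Bundles using (_⇔_; mk⇔; Equivalence)
open import Function.Definitions using (Injective)
open import Induction.WellFounded using (Acc; acc)
open import Relation.Binary using (Rel; IsEquivalence)
import Relation.Binary.Definitions as B
open import Relation.Binary.PropositionalEquality
open import Relation.Nullary using (¬_; yes; no)
import Relation.Nullary.Decidable as Dec
open import Relation.Nullary.Decidable using (decidable-stable; _×-dec_)
open import Relation.Unary using (Pred; Decidable)
open import Relation.Unary.Properties using (∁?)

private variable
  A B : Set
  P Q : Pred A 0ℓ

Enumerates⇒length≡ : ∀ {xs ys} → Enumerates P xs → Enumerates P ys → length xs ≡ length ys
Enumerates⇒length≡ (xs! , xs↔P) (ys! , ys↔P) =
  ↭-length (∼bag⇒↭ (unique∧set⇒bag xs! ys! (λ {x} →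
    mk⇔ (proj₂ (ys↔P x) ∘ proj₁ (xs↔P x)) (proj₂ (xs↔P x) ∘ proj₁ (ys↔P x)))))

filter⁺-Enumerates : (Q? : Decidable Q) → ∀ {xs} →
  Enumerates P xs → Enumerates (λ x → P x × Q x) (filter Q? xs)
filter⁺-Enumerates Q? (xs! , xs↔P) = Unique.filter⁺ Q? xs! , λ x →
  (λ x∈ → let x∈xs , Qx = ∈-filter⁻ Q? x∈ in proj₁ (xs↔P x) x∈xs , Qx) ,
  (λ (Px , Qx) → ∈-filter⁺ Q? (proj₂ (xs↔P x) Px) Qx)

record BijectionOnto (f : A → B) (P : Pred A 0ℓ) (Q : Pred B 0ℓ) : Set where
  field
    injective : Injective _≡_ _≡_ f
    into      : ∀ {x} → P x → Q (f x)
    onto      : ∀ {y} → Q y → ∃ λ x → P x × f x ≡ y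

map⁺-Enumerates : ∀ {f : A → B} → BijectionOnto f P Q →
  ∀ {xs} → Enumerates P xs → Enumerates Q (map f xs)
map⁺-Enumerates {Q = Q} {f = f} bij (xs! , xs↔P) = Unique.map⁺ injective xs! , λ y →
  (λ y∈ → let x , x∈xs , y≡fx = ∈-map⁻ f y∈ in subst Q (sym y≡fx) (into (proj₁ (xs↔P x) x∈xs))) ,
  (λ Qy → let x , Px , fx≡y = onto Qy in subst (_∈ˡ map f _) fx≡y (∈-map⁺ f (proj₂ (xs↔P x) Px)))
  where open BijectionOnto bij

bijection⇒length≡ : ∀ {f : A → B} → BijectionOnto f P Q →
  ∀ {xs ys} → Enumerates P xs → Enumerates Q ys → length xs ≡ length ys
bijection⇒length≡ {f = f} bij {xs} {ys} P-xs Q-ys = begin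
    length xs          ≡⟨ length-map f xs ⟨
    length (map f xs)  ≡⟨ Enumerates⇒length≡ (map⁺-Enumerates bij P-xs) Q-ys ⟩
    length ys          ∎
  where open ≡-Reasoning

filter-allFin-Enumerates : ∀ {n} {P : Pred (Fin n) 0ℓ} (P? : Decidable P) →
  Enumerates P (filter P? (allFin n))
filter-allFin-Enumerates {n} P? = Unique.filter⁺ P? (Unique.allFin⁺ n) , λ x →
  proj₂ ∘ ∈-filter⁻ P? {xs = allFin n} , ∈-filter⁺ P? (∈-allFin x)

module _ {P Q : Pred A 0ℓ} (P? : Decidable P) (Q? : Decidable Q) where

  filter-absorbs : (∀ {x} → P x → Q x) → ∀ xs → filter P? (filter Q? xs) ≡ filter P? xs
  filter-absorbs P⇒Q [] = refl
  filter-absorbs P⇒Q (x ∷ xs) with Q? x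
  ... | yes _ with P? x
  ...   | yes _ = cong (x ∷_) (filter-absorbs P⇒Q xs)
  ...   | no  _ = filter-absorbs P⇒Q xs
  filter-absorbs P⇒Q (x ∷ xs) | no ¬Qx =
    trans (filter-absorbs P⇒Q xs) (sym (filter-reject P? (¬Qx ∘ P⇒Q)))

module _ (P? : Decidable P) where

  length-filter+filter∁ : ∀ xs → length (filter P? xs) + length (filter (∁? P?) xs) ≡ length xs
  length-filter+filter∁ [] = refl
  length-filter+filter∁ (x ∷ xs) with P? x
  ... | yes _ = cong suc (length-filter+filter∁ xs)
  ... | no  _ = trans (+-suc _ _) (cong suc (length-filter+filter∁ xs))

module _ {R : Rel A 0ℓ} (R-isEquivalence : IsEquivalence R) (R? : B.Decidable R) where
  open IsEquivalence R-isEquivalence renaming (refl to R-refl; sym to R-sym; trans to R-trans)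

  equalClasses⇒∣length : ∀ a xs → (∀ {t} → t ∈ˡ xs → length (filter (R? t) xs) ≡ a) → a ∣ length xs
  equalClasses⇒∣length a xs = go xs (<-wellFounded (length xs))
    where
    go : ∀ xs → Acc _<_ (length xs) →
         (∀ {t} → t ∈ˡ xs → length (filter (R? t) xs) ≡ a) → a ∣ length xs
    go [] _ _ = a ∣0
    go xs@(t ∷ _) (acc shorter) classSize =
      subst (a ∣_) a+|rest|≡|xs| (∣m∣n⇒∣m+n ∣-refl (go rest (shorter rest<xs) restClassSize))
      where
      rest = filter (∁? (R? t)) xs

      a+|rest|≡|xs| : a + length rest ≡ length xs
      a+|rest|≡|xs| = trans (cong (_+ length rest) (sym (classSize (here refl))))
                            (length-filter+filter∁ (R? t) xs)

      rest<xs : length rest < length xs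
      rest<xs = filter-notAll (∁? (R? t)) xs (here (λ ¬Rtt → ¬Rtt R-refl))

      restClassSize : ∀ {u} → u ∈ˡ rest → length (filter (R? u) rest) ≡ a
      restClassSize {u} u∈rest =
        trans (cong length (filter-absorbs (R? u) (∁? (R? t)) Ru⇒¬Rt xs)) (classSize u∈xs)
        where
        u∈xs = proj₁ (∈-filter⁻ (∁? (R? t)) u∈rest)
        ¬Rtu = proj₂ (∈-filter⁻ (∁? (R? t)) u∈rest)
        Ru⇒¬Rt : ∀ {g} → R u g → ¬ R t g
        Ru⇒¬Rt Rug Rtg = ¬Rtu (R-trans Rtg (R-sym Rug))

x∈p⇒⁅x⁆⊆p : ∀ {n} {x : Fin n} {p} → x ∈ p → ⁅ x ⁆ ⊆ p
x∈p⇒⁅x⁆⊆p {x = x} {p} x∈p y∈⁅x⁆ = subst (_∈ p) (sym (x∈⁅y⁆⇒x≡y x y∈⁅x⁆)) x∈p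

⁅⁆-injective : ∀ {n} → Injective _≡_ _≡_ (⁅_⁆ {n})
⁅⁆-injective {x = x} {y} ⁅x⁆≡⁅y⁆ = x∈⁅y⁆⇒x≡y y (subst (x ∈_) ⁅x⁆≡⁅y⁆ (x∈⁅x⁆ x))

⊆⇒≡⊎⊂ : ∀ {n} {p q : Subset n} → p ⊆ q → p ≡ q ⊎ p ⊂ q
⊆⇒≡⊎⊂ {p = p} {q} p⊆q with p ⊂? q
... | yes p⊂q = inj₂ p⊂q
... | no p⊄q = inj₁ (⊆-antisym p⊆q λ {x} x∈q →
  decidable-stable (x ∈? p) λ x∉p → p⊄q (p⊆q , x , x∈q , x∉p))

module _ {n : ℕ} (G : FinGroup n) where
  open FinGroup G
  open IsGroup isGroup using (assoc; inverseˡ)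

  group : Group 0ℓ 0ℓ
  group = record { isGroup = isGroup }

  open GroupProperties group
    using ( \\-leftDividesˡ; \\-leftDividesʳ; //-rightDividesˡ
          ; ⁻¹-anti-homo-∙; ⁻¹-anti-homo-\\; ⁻¹-anti-homo-//; ∙-cancelˡ)

  coset : Subset n → Rel (Fin n) 0ℓ
  coset K t g = inv t · g ∈ K

  coset? : ∀ K → B.Decidable (coset K)
  coset? K t g = inv t · g ∈? K

  coset-isEquivalence : ∀ {K} → IsSubgroup G K → IsEquivalence (coset K)
  coset-isEquivalence (e∈K , ·-closed , inv-closed) = record
    { refl  = λ {t} → subst (_∈ _) (sym (inverseˡ t)) e∈K
    ; sym   = λ {t} {g} tK∋g → subst (_∈ _) (⁻¹-anti-homo-\\ t g) (inv-closed _ tK∋g)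
    ; trans = λ {t} {g} {u} tK∋g gK∋u → subst (_∈ _) (t⁻¹g·g⁻¹u≡t⁻¹u t g u) (·-closed _ _ tK∋g gK∋u)
    }
    where
    t⁻¹g·g⁻¹u≡t⁻¹u : ∀ t g u → (inv t · g) · (inv g · u) ≡ inv t · u
    t⁻¹g·g⁻¹u≡t⁻¹u t g u = trans (assoc (inv t) g _) (cong (inv t ·_) (\\-leftDividesˡ g u))

  leftCoset-represented-by-any-element : ∀ {x y} → IsLeftCoset G x → y ∈ x →
    ∃ λ K → IsSubgroup G K × (∀ {g} → g ∈ x ⇔ coset K y g)
  leftCoset-represented-by-any-element {x} {y} (x₀ , K , K-subgroup , x≡x₀K) y∈x =
    K , K-subgroup , mk⇔
      (λ g∈x → R-trans (R-sym (x₀-represents y∈x)) (x₀-represents g∈x))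
      (λ yK∋g → represents-x₀ (R-trans (x₀-represents y∈x) yK∋g))
    where
    open IsEquivalence (coset-isEquivalence K-subgroup)
      renaming (sym to R-sym; trans to R-trans)
    x₀-represents : ∀ {g} → g ∈ x → coset K x₀ g
    x₀-represents {g} g∈x with proj₁ (x≡x₀K g) g∈x
    ... | k , k∈K , refl = subst (_∈ K) (sym (\\-leftDividesʳ x₀ k)) k∈K
    represents-x₀ : ∀ {g} → coset K x₀ g → g ∈ x
    represents-x₀ {g} x₀K∋g = proj₂ (x≡x₀K g) (inv x₀ · g , x₀K∋g , sym (\\-leftDividesˡ x₀ g))

  ∈-translate⁺ : ∀ {h g p} → inv h · g ∈ p → g ∈ translate G h p
  ∈-translate⁺ {h} {g} {p} h⁻¹g∈p =
    lookup⇒[]= g _ (trans (lookup∘tabulate (λ u → lookup p (inv h · u)) g) ([]=⇒lookup h⁻¹g∈p))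

  ∈-translate⁻ : ∀ {h g p} → g ∈ translate G h p → inv h · g ∈ p
  ∈-translate⁻ {h} {g} {p} g∈hp =
    lookup⇒[]= _ p (trans (sym (lookup∘tabulate (λ u → lookup p (inv h · u)) g)) ([]=⇒lookup g∈hp))

  translate-⁅⁆ : ∀ h g → translate G h ⁅ g ⁆ ≡ ⁅ h · g ⁆
  translate-⁅⁆ h g = ⊆-antisym
    (λ {u} u∈h⁅g⁆ → ≡⇒∈⁅⁆
      (trans (sym (\\-leftDividesˡ h u)) (cong (h ·_) (x∈⁅y⁆⇒x≡y g (∈-translate⁻ u∈h⁅g⁆)))))
    (λ {u} u∈⁅hg⁆ → ∈-translate⁺ (≡⇒∈⁅⁆
      (trans (cong (inv h ·_) (x∈⁅y⁆⇒x≡y _ u∈⁅hg⁆)) (\\-leftDividesʳ h g))))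
    where
    ≡⇒∈⁅⁆ : ∀ {x y : Fin n} → x ≡ y → x ∈ ⁅ y ⁆
    ≡⇒∈⁅⁆ = Equivalence.from x∈⁅y⁆⇔x≡y

  module _ {H : Subset n} (H-normal : IsNormalSubgroup G H) where
    private
      H-inv = proj₂ (proj₂ (proj₁ H-normal))
      H-conj = proj₂ H-normal

    x⁻¹y∈H⇒xy⁻¹∈H : ∀ {a b} → inv a · b ∈ H → a · inv b ∈ H
    x⁻¹y∈H⇒xy⁻¹∈H {a} {b} a⁻¹b∈H =
      subst (_∈ H) (⁻¹-anti-homo-// b a)
        (H-inv _ (subst (_∈ H) (cong (_· inv a) (\\-leftDividesˡ a b)) (H-conj a _ a⁻¹b∈H)))

    module Slices {K : Subset n} (K-subgroup : IsSubgroup G K) {S : Pred (Fin n) 0ℓ}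
      (S-closed : ∀ {h g} → h ∈ H → S g → S (h · g))
      (S-noThreeCosets : ∀ {a b c} → S a → S b → S c →
        ¬ ((inv a · b ∉ H) × (inv a · c ∉ H) × (inv b · c ∉ H)))
      where
      private
        K-inv = proj₂ (proj₂ K-subgroup)

      Slice : Fin n → Pred (Fin n) 0ℓ
      Slice t g = S g × coset K t g

      S-closedʳ : ∀ {g h} → h ∈ H → S g → S (g · h)
      S-closedʳ {g} {h} h∈H Sg = subst S (//-rightDividesˡ g (g · h)) (S-closed (H-conj g h h∈H) Sg)

      translation-bijection : ∀ {t t'} → inv t · t' ∈ H →
        BijectionOnto ((t · inv t') ·_) (Slice t') (Slice t)
      translation-bijection {t} {t'} t⁻¹t'∈H = record
        { injective = ∙-cancelˡ c _ _
        ; into      = λ (Sz , t'K∋z) → S-closed c∈H Sz , subst (_∈ K) (sym (shift _)) t'K∋z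
        ; onto      = λ {w} (Sw , tK∋w) →
            inv c · w , (S-closed (H-inv _ c∈H) Sw ,
                         subst (_∈ K) (trans (cong (inv t ·_) (sym (\\-leftDividesˡ c w))) (shift _)) tK∋w) ,
            \\-leftDividesˡ c w
        }
        where
        c = t · inv t'
        c∈H = x⁻¹y∈H⇒xy⁻¹∈H t⁻¹t'∈H
        shift : ∀ z → inv t · (c · z) ≡ inv t' · z
        shift z = trans (cong (inv t ·_) (assoc t (inv t') z)) (\\-leftDividesʳ t _)

      antiTranslate : Fin n → Fin n → Fin n → Fin n
      antiTranslate t t' z = t · inv z · t'

      antiTranslate-inverse : ∀ t t' w → antiTranslate t t' (antiTranslate t' t w) ≡ w
      antiTranslate-inverse t t' w = begin
        t · inv (t' · inv w · t) · t'      ≡⟨ cong (λ v → t · v · t') (⁻¹-anti-homo-∙ (t' · inv w) t) ⟩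
        t · (inv t · inv (t' · inv w)) · t' ≡⟨ cong (_· t') (\\-leftDividesˡ t _) ⟩
        inv (t' · inv w) · t'              ≡⟨ cong (_· t') (⁻¹-anti-homo-// t' w) ⟩
        w · inv t' · t'                    ≡⟨ //-rightDividesˡ t' w ⟩
        w                                  ∎
        where open ≡-Reasoning

      antiTranslate-coset : ∀ t t' z → inv t · antiTranslate t t' z ≡ inv (inv t' · z)
      antiTranslate-coset t t' z = begin
        inv t · (t · inv z · t')   ≡⟨ cong (inv t ·_) (assoc t (inv z) t') ⟩
        inv t · (t · (inv z · t')) ≡⟨ \\-leftDividesʳ t _ ⟩
        inv z · t'                 ≡⟨ ⁻¹-anti-homo-\\ t' z ⟨
        inv (inv t' · z)           ∎
        where open ≡-Reasoning

      antiTranslate-preserves-S : ∀ {t t' z} → S t → S t' → inv t · t' ∉ H → S z →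
        S (antiTranslate t t' z)
      antiTranslate-preserves-S {t} {t'} {z} St St' t⁻¹t'∉H Sz with inv t · z ∈? H | inv t' · z ∈? H
      ... | yes t⁻¹z∈H | _ = S-closed (x⁻¹y∈H⇒xy⁻¹∈H t⁻¹z∈H) St'
      ... | no _ | yes t'⁻¹z∈H = subst S t·[t'⁻¹z]⁻¹≡tz⁻¹t' (S-closedʳ (H-inv _ t'⁻¹z∈H) St)
        where
        t·[t'⁻¹z]⁻¹≡tz⁻¹t' : t · inv (inv t' · z) ≡ t · inv z · t'
        t·[t'⁻¹z]⁻¹≡tz⁻¹t' = trans (cong (t ·_) (⁻¹-anti-homo-\\ t' z)) (sym (assoc t (inv z) t'))
      ... | no t⁻¹z∉H | no t'⁻¹z∉H = ⊥-elim (S-noThreeCosets St St' Sz (t⁻¹t'∉H , t⁻¹z∉H , t'⁻¹z∉H))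

      antiTranslation-bijection : ∀ {t t'} → S t → S t' → inv t · t' ∉ H →
        BijectionOnto (antiTranslate t t') (Slice t') (Slice t)
      antiTranslation-bijection {t} {t'} St St' t⁻¹t'∉H = record
        { injective = λ {z₁} {z₂} eq → begin
            z₁                                          ≡⟨ antiTranslate-inverse t' t z₁ ⟨
            antiTranslate t' t (antiTranslate t t' z₁)  ≡⟨ cong (antiTranslate t' t) eq ⟩
            antiTranslate t' t (antiTranslate t t' z₂)  ≡⟨ antiTranslate-inverse t' t z₂ ⟩
            z₂                                          ∎
        ; into      = λ {z} (Sz , t'K∋z) →
            antiTranslate-preserves-S St St' t⁻¹t'∉H Sz ,
            subst (_∈ K) (sym (antiTranslate-coset t t' z)) (K-inv _ t'K∋z)
        ; onto      = λ {w} (Sw , tK∋w) →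
            antiTranslate t' t w ,
            (antiTranslate-preserves-S St' St t'⁻¹t∉H Sw ,
             subst (_∈ K) (sym (antiTranslate-coset t' t w)) (K-inv _ tK∋w)) ,
            antiTranslate-inverse t t' w
        }
        where
        open ≡-Reasoning
        t'⁻¹t∉H : inv t' · t ∉ H
        t'⁻¹t∉H t'⁻¹t∈H = t⁻¹t'∉H (subst (_∈ H) (⁻¹-anti-homo-\\ t' t) (H-inv _ t'⁻¹t∈H))

      slices-equinumerous : ∀ {xs t t'} → Enumerates S xs → S t → S t' →
        length (filter (coset? K t') xs) ≡ length (filter (coset? K t) xs)
      slices-equinumerous {xs} {t} {t'} S-xs St St' = bijection⇒length≡ (proj₂ bijection)
        (filter⁺-Enumerates (coset? K t') S-xs) (filter⁺-Enumerates (coset? K t) S-xs)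
        where
        bijection : ∃ λ f → BijectionOnto f (Slice t') (Slice t)
        bijection with inv t · t' ∈? H
        ... | yes t⁻¹t'∈H = _ , translation-bijection t⁻¹t'∈H
        ... | no t⁻¹t'∉H = _ , antiTranslation-bijection St St' t⁻¹t'∉H

      slice∣length : ∀ {xs y} → Enumerates S xs → S y → length (filter (coset? K y) xs) ∣ length xs
      slice∣length {xs} S-xs Sy = equalClasses⇒∣length (coset-isEquivalence K-subgroup) (coset? K) _ xs
        (λ t∈xs → slices-equinumerous S-xs Sy (proj₁ (proj₂ S-xs _) t∈xs))

module _ {n : ℕ} (G : FinGroup n) {L : Pred (Subset n) 0ℓ} where

  ¬¬L∅ : (∀ a b → L a → L b → L (a ∩ b)) → ∀ {g} → IsJoinIrr G L ⁅ g ⁆ → ¬ ¬ L ∅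
  ¬¬L∅ ∩-closed {g} (L⁅g⁆ , ⁅g⁆-not-bottom , _) ¬L∅ = ⁅g⁆-not-bottom (L⁅g⁆ , ⁅g⁆⊆)
    where
    ⁅g⁆⊆ : ∀ y → L y → ⁅ g ⁆ ⊆ y
    ⁅g⁆⊆ y Ly with g ∈? y
    ... | yes g∈y = x∈p⇒⁅x⁆⊆p g∈y
    ... | no g∉y = ⊥-elim (¬L∅ (subst L ⁅g⁆∩y≡∅ (∩-closed _ _ L⁅g⁆ Ly)))
      where
      ⁅g⁆∩y≡∅ : ⁅ g ⁆ ∩ y ≡ ∅
      ⁅g⁆∩y≡∅ = Empty-unique λ (u , u∈⁅g⁆∩y) →
        let u∈⁅g⁆ , u∈y = x∈p∩q⁻ ⁅ g ⁆ y u∈⁅g⁆∩y in g∉y (subst (_∈ y) (x∈⁅y⁆⇒x≡y g u∈⁅g⁆) u∈y)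

  module _ (L∅ : L ∅) where

    ∅-isBottom : IsBottom G L ∅
    ∅-isBottom = L∅ , λ _ _ → ⊥⊆

    atom⇒joinIrreducible : ∀ {z} → L z → Nonempty z → (∀ {a} → L a → a ⊂ z → a ≡ ∅) →
      IsJoinIrr G L z
    atom⇒joinIrreducible {z} Lz (g , g∈z) below⇒∅ =
      Lz , (λ (_ , z⊆all) → ∉⊥ (z⊆all ∅ L∅ g∈z)) , join
      where
      join : ∀ a b → L a → L b → IsJoinC G a b z → a ≡ z ⊎ b ≡ z
      join a b La Lb (_ , a⊆z , b⊆z , least) with ⊆⇒≡⊎⊂ a⊆z | ⊆⇒≡⊎⊂ b⊆z
      ... | inj₁ a≡z | _        = inj₁ a≡z
      ... | inj₂ _   | inj₁ b≡z = inj₂ b≡z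
      ... | inj₂ a⊂z | inj₂ b⊂z = ⊥-elim (∉⊥ (least ∅ (inj₁ refl)
            (⊆-reflexive (below⇒∅ La a⊂z)) (⊆-reflexive (below⇒∅ Lb b⊂z)) g∈z))

    singleton-joinIrreducible : ∀ {g} → L ⁅ g ⁆ → IsJoinIrr G L ⁅ g ⁆
    singleton-joinIrreducible {g} L⁅g⁆ = atom⇒joinIrreducible L⁅g⁆ (g , x∈⁅x⁆ g)
      λ {a} _ (a⊆⁅g⁆ , u , u∈⁅g⁆ , u∉a) → Empty-unique λ (v , v∈a) →
        u∉a (subst (_∈ a) (trans (x∈⁅y⁆⇒x≡y g (a⊆⁅g⁆ v∈a)) (sym (x∈⁅y⁆⇒x≡y g u∈⁅g⁆))) v∈a)

    module _ (singletons : ∀ j → IsJoinIrr G L j → ∃ λ g → j ≡ ⁅ g ⁆)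
             (S? : Decidable (λ g → IsJoinIrr G L ⁅ g ⁆)) where

      joinIrreducible-below : ∀ {z} → L z → Nonempty z → ∃ λ g → g ∈ z × IsJoinIrr G L ⁅ g ⁆
      joinIrreducible-below {z} = go z (<-wellFounded ∣ z ∣)
        where
        go : ∀ z → Acc _<_ ∣ z ∣ → L z → Nonempty z → ∃ λ g → g ∈ z × IsJoinIrr G L ⁅ g ⁆
        go z (acc smaller) Lz z-nonempty with any? (λ g → g ∈? z ×-dec S? g)
        ... | yes found = found
        ... | no none =
          ⊥-elim (none (g , subst (g ∈_) (sym z≡⁅g⁆) (x∈⁅x⁆ g) ,
                        subst (IsJoinIrr G L) z≡⁅g⁆ z-joinIrreducible))
          where
          z-joinIrreducible : IsJoinIrr G L z
          z-joinIrreducible = atom⇒joinIrreducible Lz z-nonempty λ {a} La a⊂z →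
            Empty-unique λ a-nonempty →
              let g , g∈a , Sg = go a (smaller (p⊂q⇒∣p∣<∣q∣ a⊂z)) La a-nonempty
              in none (g , proj₁ a⊂z g∈a , Sg)
          g = proj₁ (singletons z z-joinIrreducible)
          z≡⁅g⁆ = proj₂ (singletons z z-joinIrreducible)

module _ {n : ℕ} (G : FinGroup n) (L : Pred (Subset n) 0ℓ) (good : IsGood G L) (L∅ : L ∅) where
  open FinGroup G
  private
    inC          = proj₁ (proj₁ good)
    H            = proj₁ (proj₂ good)
    H-normal     = proj₁ (proj₂ (proj₂ good))
    H-acts       = proj₁ (proj₂ (proj₂ (proj₂ good)))
    singletons   = proj₁ (proj₂ (proj₂ (proj₂ (proj₂ good))))
    threeCosets  = proj₂ (proj₂ (proj₂ (proj₂ (proj₂ good))))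

  JoinIrreducibleElement : Pred (Fin n) 0ℓ
  JoinIrreducibleElement g = IsJoinIrr G L ⁅ g ⁆

  JoinIrreducibleElement-closed : ∀ {h g} → h ∈ H → JoinIrreducibleElement g →
    JoinIrreducibleElement (h · g)
  JoinIrreducibleElement-closed {h} {g} h∈H (L⁅g⁆ , _) =
    singleton-joinIrreducible G L∅ (subst L (translate-⁅⁆ G h g) (H-acts ⁅ g ⁆ h L⁅g⁆ h∈H))

  module _ (js : List (Subset n)) (J-js : Enumerates (IsJoinIrr G L) js) where

    joinIrreducibleElement? : Decidable JoinIrreducibleElement
    joinIrreducibleElement? g =
      Dec.map (mk⇔ (proj₁ (proj₂ J-js ⁅ g ⁆)) (proj₂ (proj₂ J-js ⁅ g ⁆)))
              (DecMembership._∈?_ (≡-dec Bool._≟_) ⁅ g ⁆ js)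

    joinIrreducibleElements : List (Fin n)
    joinIrreducibleElements = filter joinIrreducibleElement? (allFin n)

    joinIrreducibleElements-Enumerates : Enumerates JoinIrreducibleElement joinIrreducibleElements
    joinIrreducibleElements-Enumerates = filter-allFin-Enumerates joinIrreducibleElement?

    |joinIrreducibleElements|≡|J| : length joinIrreducibleElements ≡ length js
    |joinIrreducibleElements|≡|J| = bijection⇒length≡ record
      { injective = ⁅⁆-injective
      ; into      = λ J⁅g⁆ → J⁅g⁆
      ; onto      = λ Jj → let g , j≡⁅g⁆ = singletons _ Jj in
                           g , subst (IsJoinIrr G L) j≡⁅g⁆ Jj , sym j≡⁅g⁆
      } joinIrreducibleElements-Enumerates J-js

    module _ {x} (Lx : L x) (x-not-bottom : ¬ IsBottom G L x) where

      x-nonempty : Nonempty x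
      x-nonempty = decidable-stable (nonempty? x) λ x-empty →
        x-not-bottom (subst (IsBottom G L) (sym (Empty-unique x-empty)) (∅-isBottom G L∅))

      representative : ∃ λ y → y ∈ x × JoinIrreducibleElement y
      representative = joinIrreducible-below G L∅ singletons joinIrreducibleElement? Lx x-nonempty

      y   = proj₁ representative
      y∈x = proj₁ (proj₂ representative)
      J⁅y⁆ = proj₂ (proj₂ representative)

      x-isCoset : ∃ λ K → IsSubgroup G K × (∀ {g} → g ∈ x ⇔ coset G K y g)
      x-isCoset with inC x Lx
      ... | inj₁ x≡∅ = ⊥-elim (∉⊥ (subst (y ∈_) x≡∅ y∈x))
      ... | inj₂ x-coset = leftCoset-represented-by-any-element G x-coset y∈x

      K = proj₁ x-isCoset
      open Slices G H-normal (proj₁ (proj₂ x-isCoset)) JoinIrreducibleElement-closed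
        (λ {a} {b} {c} → threeCosets a b c)

      ⁅⁆-bijection : BijectionOnto ⁅_⁆ (Slice y) (λ j → IsJoinIrr G L j × j ⊆ x)
      ⁅⁆-bijection = record
        { injective = ⁅⁆-injective
        ; into      = λ (J⁅g⁆ , yK∋g) → J⁅g⁆ , x∈p⇒⁅x⁆⊆p (Equivalence.from x≡yK yK∋g)
        ; onto      = λ (Jj , j⊆x) → let g , j≡⁅g⁆ = singletons _ Jj in
            g , (subst (IsJoinIrr G L) j≡⁅g⁆ Jj ,
                 Equivalence.to x≡yK (j⊆x (subst (g ∈_) (sym j≡⁅g⁆) (x∈⁅x⁆ g)))) , sym j≡⁅g⁆
        }
        where
        x≡yK = proj₂ (proj₂ x-isCoset)

      |J_x|∣|J| : ∀ {ks} → Enumerates (λ j → IsJoinIrr G L j × j ⊆ x) ks → length ks ∣ length js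
      |J_x|∣|J| J_x-ks = subst₂ _∣_
        (bijection⇒length≡ ⁅⁆-bijection
          (filter⁺-Enumerates (coset? G K y) joinIrreducibleElements-Enumerates) J_x-ks)
        |joinIrreducibleElements|≡|J|
        (slice∣length joinIrreducibleElements-Enumerates J⁅y⁆)

-- L is an arbitrary predicate, so L ∅ (the meet of ⁅ g ⁆, for g ∈ J(L), with an element not
-- containing g) is only available doubly negated; divisibility is decidable, so this suffices.
mainTheorem10 : ∀ (n : ℕ) (G : FinGroup n) (L : Pred (Subset n) 0ℓ) →
    IsGood G L → StronglyCosetLike G L
mainTheorem10 n G L good [] _ _ _ _ ks _ = length ks ∣0
mainTheorem10 n G L good@((_ , ∩-closed , _) , _ , _ , _ , singletons , _)
              js@(j ∷ _) J-js x Lx x-not-bottom ks J_x-ks =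
  decidable-stable (length ks ∣? length js) λ ∤ →
    ¬¬L∅ G ∩-closed J⁅g⁆ λ L∅ →
      ∤ (|J_x|∣|J| G L good L∅ js J-js Lx x-not-bottom J_x-ks)
  where
  Jj = proj₁ (proj₂ J-js j) (here refl)
  J⁅g⁆ = subst (IsJoinIrr G L) (proj₂ (singletons j Jj)) Jj
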